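{- Let $D=(V,E)$ be a finite undirected graph, $k$ a positive integer, and $\mathcal{R}_D$ a $k$-regionalization of $D$. If $D$ contains a $k$-clique $C$, then all vertices of $C$ lie in the same region of $\mathcal{R}_D$.
   Context: For $R\subseteq V$ and $v\in R$, let $\mathsf{ext}(v)$ be the number of edges between $v$ and vertices not in $R$. The set $R$ is a $k$-region of $D$ if for every integer $i$ with $0<i<k$, the set $\{v\in R\mid \mathsf{ext}(v)\ge i\}$ has fewer than $k-i$ elements. A $k$-regionalization of $D$ is a partition of $V$ into $k$-regions. A $k$-clique is a set of $k$ pairwise adjacent vertices. -}

module Defs where

open import Data.Nat using (ℕ; zero; suc; _<_; _≥_; _∸_)
open import Data.Fin using (Fin)
open import Data.Fin.Subset using (Subset; _∈_; _∉_; ∣_∣; ⁅_⁆)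
open import Data.Vec using (tabulate)
open import Data.Bool using (Bool; true; false)
open import Data.Product using (_×_)
open import Relation.Nullary using (¬_; Dec; does)
open import Relation.Nullary.Decidable using (⌊_⌋)
open import Relation.Binary.PropositionalEquality using (_≡_)
open import Data.Fin.Subset.Properties using (_∈?_)

record Graph (n : ℕ) : Set₁ where
  field
    Adj      : Fin n → Fin n → Set
    adj?     : ∀ u v → Dec (Adj u v)
    sym      : ∀ {u v} → Adj u v → Adj v u
    irrefl   : ∀ {u} → ¬ Adj u u

open Graph public

filterS : ∀ {n} → (Fin n → Bool) → Subset n
filterS f = tabulate f

-- ext(v) : number of edges between v and vertices not in R
-- (simple graph: edges from v correspond to neighbours of v)
ext : ∀ {n} → Graph n → Subset n → Fin n → ℕ
ext D R v = ∣ filterS (λ u → ⌊ adj? D v u ⌋ Data.Bool.∧ Data.Bool.not ⌊ u ∈? R ⌋) ∣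

highExt : ∀ {n} → Graph n → Subset n → ℕ → Subset n
highExt D R i = filterS (λ v → ⌊ v ∈? R ⌋ Data.Bool.∧ ⌊ i Data.Nat.≤? ext D R v ⌋)

IsRegion : ∀ {n} → Graph n → ℕ → Subset n → Set
IsRegion D k R = ∀ (i : ℕ) → 0 < i → i < k → ∣ highExt D R i ∣ < k ∸ i

regionOf : ∀ {n m} → (Fin n → Fin m) → Fin m → Subset n
regionOf r j = filterS (λ v → ⌊ r v Data.Fin.≟ j ⌋)

-- A k-regionalization: a partition of V, given by assigning each vertex a
-- region label, such that every part is a k-region.
IsRegionalization : ∀ {n m} → Graph n → ℕ → (Fin n → Fin m) → Set
IsRegionalization D k r = ∀ j → IsRegion D k (regionOf r j)

IsClique : ∀ {n} → Graph n → ℕ → Subset n → Set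
IsClique D k C = (∣ C ∣ ≡ k) × (∀ u v → u ∈ C → v ∈ C → ¬ u ≡ v → Adj D u v)

-- Suppose a k-clique C meets a region R in a vertices and has b = k − a vertices outside it, with
-- a, b ≥ 1. Every clique vertex inside R is adjacent to the b clique vertices outside R, so it has
-- ext ≥ b; thus R has at least a vertices with ext ≥ b, while being a k-region allows fewer than
-- k − b = a of them.
module Submission where

open import Defs hiding (sym)
open import Data.Nat using (ℕ; suc; _+_; _≤_; _<_; _>_; _∸_; _≤?_; s≤s)
open import Data.Nat.Properties using (m+n∸n≡m; +-monoˡ-≤; <-≤-trans; <-irrefl; +-suc)
open import Data.Bool using (Bool; T)
open import Data.Bool.Properties using (T-≡; T-∧)
open import Data.Fin using (Fin; _≟_)
open import Data.Fin.Subset using (Subset; _∈_; _∉_; _⊆_; _∩_; ∁; ∣_∣; inside; outside)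
open import Data.Fin.Subset.Properties
  using (_∈?_; x∈p∩q⁺; x∈p∩q⁻; x∉p⇒x∈∁p; x∈∁p⇒x∉p; p⊆q⇒∣p∣≤∣q∣; x∈⁅y⁆⇒x≡y; ∣⁅x⁆∣≡1)
open import Data.Vec using (_∷_; []; tabulate)
open import Data.Vec.Properties using (lookup∘tabulate; []=⇒lookup; lookup⇒[]=)
open import Data.Product using (_×_; _,_)
open import Function using (Equivalence)
open import Data.Empty using (⊥; ⊥-elim)
open import Relation.Nullary using (¬_; yes; no)
open import Relation.Nullary.Decidable using (toWitness; fromWitness; fromWitnessFalse)
open import Relation.Binary.PropositionalEquality using (_≡_; refl; sym; trans; cong; subst)

private
  variable
    n : ℕ

∈-filterS⁺ : ∀ (f : Fin n → Bool) {x} → T (f x) → x ∈ filterS f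
∈-filterS⁺ f {x} fx = lookup⇒[]= x (tabulate f)
  (trans (lookup∘tabulate f x) (Equivalence.to T-≡ fx))

∈-filterS⁻ : ∀ (f : Fin n → Bool) {x} → x ∈ filterS f → T (f x)
∈-filterS⁻ f {x} x∈ = Equivalence.from T-≡
  (trans (sym (lookup∘tabulate f x)) ([]=⇒lookup x∈))

∣p∩q∣+∣p∩∁q∣≡∣p∣ : ∀ (p q : Subset n) → ∣ p ∩ q ∣ + ∣ p ∩ ∁ q ∣ ≡ ∣ p ∣
∣p∩q∣+∣p∩∁q∣≡∣p∣ []            []            = refl
∣p∩q∣+∣p∩∁q∣≡∣p∣ (inside ∷ p)  (inside ∷ q)  = cong suc (∣p∩q∣+∣p∩∁q∣≡∣p∣ p q)
∣p∩q∣+∣p∩∁q∣≡∣p∣ (inside ∷ p)  (outside ∷ q) =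
  trans (+-suc _ _) (cong suc (∣p∩q∣+∣p∩∁q∣≡∣p∣ p q))
∣p∩q∣+∣p∩∁q∣≡∣p∣ (outside ∷ p) (inside ∷ q)  = ∣p∩q∣+∣p∩∁q∣≡∣p∣ p q
∣p∩q∣+∣p∩∁q∣≡∣p∣ (outside ∷ p) (outside ∷ q) = ∣p∩q∣+∣p∩∁q∣≡∣p∣ p q

x∈p⇒1≤∣p∣ : ∀ {x : Fin n} {p} → x ∈ p → 1 ≤ ∣ p ∣
x∈p⇒1≤∣p∣ {x = x} {p} x∈p = subst (_≤ ∣ p ∣) (∣⁅x⁆∣≡1 x)
  (p⊆q⇒∣p∣≤∣q∣ λ y∈⁅x⁆ → subst (_∈ p) (sym (x∈⁅y⁆⇒x≡y x y∈⁅x⁆)) x∈p)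

module _ (D : Graph n) where

  ∈-regionOf⁺ : ∀ {m} (r : Fin n → Fin m) {v j} → r v ≡ j → v ∈ regionOf r j
  ∈-regionOf⁺ r rv≡j = ∈-filterS⁺ _ (fromWitness rv≡j)

  ∈-regionOf⁻ : ∀ {m} (r : Fin n → Fin m) {v j} → v ∈ regionOf r j → r v ≡ j
  ∈-regionOf⁻ r v∈ = toWitness (∈-filterS⁻ _ v∈)

  ∈-highExt⁺ : ∀ {R v i} → v ∈ R → i ≤ ext D R v → v ∈ highExt D R i
  ∈-highExt⁺ {R} {v} {i} v∈R i≤ext = ∈-filterS⁺ _ (Equivalence.from T-∧
    (fromWitness {a? = v ∈? R} v∈R , fromWitness {a? = i ≤? ext D R v} i≤ext))

  ext-≥ : ∀ {R v} {X : Subset n} → (∀ {x} → x ∈ X → Adj D v x × x ∉ R) → ∣ X ∣ ≤ ext D R v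
  ext-≥ {R} {v} outsideNeighbours = p⊆q⇒∣p∣≤∣q∣ λ {x} x∈X →
    let adj , x∉R = outsideNeighbours x∈X
    in ∈-filterS⁺ _ (Equivalence.from T-∧
         (fromWitness {a? = adj? D v x} adj , fromWitnessFalse {a? = x ∈? R} x∉R))

  IsComplete : Subset n → Set
  IsComplete C = ∀ u v → u ∈ C → v ∈ C → ¬ u ≡ v → Adj D u v

  complete-∩-⊆-highExt : ∀ {C R} → IsComplete C → C ∩ R ⊆ highExt D R ∣ C ∩ ∁ R ∣
  complete-∩-⊆-highExt {C} {R} complete {v} v∈C∩R =
    let v∈C , v∈R = x∈p∩q⁻ C R v∈C∩R
    in ∈-highExt⁺ v∈R (ext-≥ λ x∈C∩∁R →
         let x∈C , x∈∁R = x∈p∩q⁻ C (∁ R) x∈C∩∁R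
             x∉R = x∈∁p⇒x∉p x∈∁R
         in complete v _ v∈C x∈C (λ { refl → x∉R v∈R }) , x∉R)

  region-highExt-bound : ∀ {k R i} {X : Subset n} → IsRegion D k R → 1 ≤ i → i < k →
                         X ⊆ highExt D R i → ∣ X ∣ < k ∸ i
  region-highExt-bound region 1≤i i<k X⊆H = <-≤-trans (s≤s (p⊆q⇒∣p∣≤∣q∣ X⊆H)) (region _ 1≤i i<k)

  complete-¬straddles-region : ∀ {k R} {C : Subset n} {u v} →
    IsRegion D k R → IsComplete C → ∣ C ∣ ≡ k →
    u ∈ C ∩ R → v ∈ C ∩ ∁ R → ⊥
  complete-¬straddles-region {k} {R} {C} region complete ∣C∣≡k u∈C∩R v∈C∩∁R =
    <-irrefl refl (subst (a <_) k∸b≡a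
      (region-highExt-bound region (x∈p⇒1≤∣p∣ v∈C∩∁R) b<k (complete-∩-⊆-highExt complete)))
    where
    a b : ℕ
    a = ∣ C ∩ R ∣
    b = ∣ C ∩ ∁ R ∣
    a+b≡k : a + b ≡ k
    a+b≡k = trans (∣p∩q∣+∣p∩∁q∣≡∣p∣ C R) ∣C∣≡k
    b<k : b < k
    b<k = subst (b <_) a+b≡k (+-monoˡ-≤ b (x∈p⇒1≤∣p∣ u∈C∩R))
    k∸b≡a : k ∸ b ≡ a
    k∸b≡a = subst (λ t → t ∸ b ≡ a) a+b≡k (m+n∸n≡m a b)

lemma2 : ∀ {n m} (D : Graph n) (k : ℕ) → k > 0 → (r : Fin n → Fin m) →
         IsRegionalization D k r → (C : Subset n) → IsClique D k C →
         ∀ u v → u ∈ C → v ∈ C → r u ≡ r v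
lemma2 D k _ r regionalization C (∣C∣≡k , complete) u v u∈C v∈C with r v ≟ r u
... | yes rv≡ru = sym rv≡ru
... | no  rv≢ru = ⊥-elim (complete-¬straddles-region D
        (regionalization (r u)) complete ∣C∣≡k
        (x∈p∩q⁺ (u∈C , ∈-regionOf⁺ D r refl))
        (x∈p∩q⁺ (v∈C , x∉p⇒x∈∁p (λ v∈R → rv≢ru (∈-regionOf⁻ D r v∈R)))))
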